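{- Let $n$ be a positive integer and let $a=(a_1,\ldots,a_n)$, $b=(b_1,\ldots,b_n)$ be vectors of nonnegative integers with $0\le a_k\le b_k$ for all $k\in[n]$. Then for all $j\in[n]$, \[\mathsf{invol}_j(b)\le \mathsf{invol}_j(a)\,n^{\|b-a\|_1}\prod_{k=1}^n\exp\!\left(\frac{b_k^2}{2k}\right),\] where $\|b-a\|_1=\sum_{k=1}^n (b_k-a_k)$.
   Context: For nonnegative integers $a_1,a_2,\ldots$ and a positive integer $m$, \[\mathsf{invol}_m(a)=\prod_{k=1}^m k^{a_k}\sum_{j=0}^{\lfloor a_k/2\rfloor}\frac{(a_k)_{2j}}{(2k)^j j!},\] where $(x)_r=x(x-1)\cdots(x-r+1)$ is the falling factorial. -}

module Defs where

open import Data.Nat as ℕ using (ℕ; zero; suc; _∸_; _<ᵇ_; NonZero)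
open import Data.Nat using (_!)
open import Data.Nat.Properties using (_!≢0)
open import Data.Integer using (+_)
open import Data.Rational using (ℚ; _+_; _*_; _/_; _≤_; _<_; 0ℚ; 1ℚ)
open import Data.Fin using (Fin; toℕ)
open import Data.List using (List; foldr; map; upTo; allFin; filter)
open import Data.Bool using (if_then_else_)
open import Data.Product using (∃-syntax)

⟦_⟧ : ℕ → ℚ
⟦ n ⟧ = + n / 1

Σℚ : List ℚ → ℚ
Σℚ = foldr _+_ 0ℚ

Πℚ : List ℚ → ℚ
Πℚ = foldr _*_ 1ℚ

_^ℚ_ : ℚ → ℕ → ℚ
q ^ℚ zero = 1ℚ
q ^ℚ suc r = q * (q ^ℚ r)

falling : ℕ → ℕ → ℕ
falling x zero = 1
falling x (suc r) = (x ∸ r) ℕ.* falling x r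

inv! : ℕ → ℚ
inv! j = (+ 1 / (j !)) {{j !≢0}}

-- the k-th factor of invol, for k = suc k' ≥ 1:
--   k^{x} * Σ_{j=0}^{⌊x/2⌋} (x)_{2j} / ((2k)^j j!)
involFactor : (k' : ℕ) → (x : ℕ) → ℚ
involFactor k' x =
  (⟦ suc k' ⟧ ^ℚ x) *
  Σℚ (map (λ j → ⟦ falling x (2 ℕ.* j) ⟧ * ((+ 1 / (2 ℕ.* suc k')) ^ℚ j) * inv! j)
          (upTo (suc (x ℕ./ 2))))

-- invol_m(a) for a vector a = (a_1,...,a_n) given as a : Fin n → ℕ,
-- index i : Fin n standing for k = toℕ i + 1; product over k = 1..m.
invol : {n : ℕ} → ℕ → (Fin n → ℕ) → ℚ
invol {n} m a =
  Πℚ (map (λ i → involFactor (toℕ i) (a i))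
          (filter (λ i → Data.Nat._<?_ (toℕ i) m) (allFin n)))
  where import Data.Nat

dist₁ : {n : ℕ} → (Fin n → ℕ) → (Fin n → ℕ) → ℕ
dist₁ {n} b a = foldr ℕ._+_ 0 (map (λ i → b i ∸ a i) (allFin n))

expPartial : ℕ → ℚ → ℚ
expPartial N c = Σℚ (map (λ i → (c ^ℚ i) * inv! i) (upTo N))

expArg : {n : ℕ} → (Fin n → ℕ) → Fin n → ℚ
expArg b i = ⟦ b i ℕ.* b i ⟧ * (+ 1 / (2 ℕ.* suc (toℕ i)))

-- x ≤ y · Π_{k} exp(c_k), with exp given by its power series:
-- since all c_k ≥ 0 and y ≥ 0 in our use, Π_k exp(c_k) is the supremum over N of
-- Π_k (Σ_{i<N} c_k^i/i!), so the real inequality holds iff for every ε > 0 some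
-- partial product satisfies x ≤ y · Π_k S_N(c_k) + ε.
_≤_·Πexp_ : {n : ℕ} → ℚ → ℚ → (Fin n → ℚ) → Set
_≤_·Πexp_ {n} x y c =
  (ε : ℚ) → 0ℚ < ε →
  ∃[ N ] (x ≤ y * Πℚ (map (λ i → expPartial N (c i)) (allFin n)) + ε)

{-# OPTIONS --safe #-}
-- Factor by factor, the k-th term (b_k)_{2j}/((2k)^j j!) of invol is at most (b_k²/2k)^j/j!, so
-- the k-th factor of invol_j(b) is at most k^{b_k} exp(b_k²/2k); conversely the j = 0 term shows
-- the k-th factor of invol_j(a) is at least k^{a_k}, and k^{b_k - a_k} ≤ n^{b_k - a_k}.
-- The exponentials are replaced by partial sums of length N > max b, which already dominate the
-- truncated sums in invol. Factors with k > j occur only on the right, where they are at least 1.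
module Submission where

open import Defs
open import Data.Nat using (ℕ; suc; _≤_; _>_)
open import Data.Fin using (Fin; toℕ)
import Data.Rational

open import Data.Nat as ℕ using (zero; _∸_; _⊔_; s≤s; z≤n)
import Data.Nat.Properties as ℕP
open import Data.Nat.DivMod using (m/n≤m)
open import Data.Nat.Coprimality using (1-coprimeTo) renaming (sym to coprime-sym)
open import Data.Integer as ℤ using (+_; +≤+)
import Data.Integer.Properties as ℤP
import Data.Rational as Q
open Q using (ℚ; mkℚ; 0ℚ; 1ℚ)
import Data.Rational.Properties as QP
open import Data.Fin.Properties using (toℕ<n)
open import Data.List using ([]; _∷_; map; foldr; applyUpTo; filter; allFin)
open import Data.List.Properties using (map-upTo)
open import Data.Bool using (true; false)
open import Data.Product using (_,_)
open import Relation.Nullary using (does)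
open import Relation.Unary using (Pred; Decidable)
open import Relation.Binary.PropositionalEquality
open import Data.Rational.Solver using (module +-*-Solver)

⟦⟧≡mkℚ : ∀ n → ⟦ n ⟧ ≡ mkℚ (+ n) 0 (coprime-sym (1-coprimeTo n))
⟦⟧≡mkℚ n = QP.normalize-coprime (coprime-sym (1-coprimeTo n))

⟦⟧-* : ∀ m n → ⟦ m ⟧ Q.* ⟦ n ⟧ ≡ ⟦ m ℕ.* n ⟧
⟦⟧-* m n = trans (cong₂ Q._*_ (⟦⟧≡mkℚ m) (⟦⟧≡mkℚ n)) (cong (Q._/ 1) (sym (ℤP.pos-* m n)))

⟦⟧-mono-≤ : ∀ {m n} → m ≤ n → ⟦ m ⟧ Q.≤ ⟦ n ⟧
⟦⟧-mono-≤ {m} {n} m≤n rewrite ⟦⟧≡mkℚ m | ⟦⟧≡mkℚ n =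
  Q.*≤* (subst₂ ℤ._≤_ (sym (ℤP.*-identityʳ (+ m))) (sym (ℤP.*-identityʳ (+ n)))
                (+≤+ m≤n))

0≤⟦⟧ : ∀ n → 0ℚ Q.≤ ⟦ n ⟧
0≤⟦⟧ n = ⟦⟧-mono-≤ {0} {n} z≤n

0≤1 : 0ℚ Q.≤ 1ℚ
0≤1 = QP.<⇒≤ (QP.positive⁻¹ 1ℚ)

1≤⇒0≤ : ∀ {p} → 1ℚ Q.≤ p → 0ℚ Q.≤ p
1≤⇒0≤ = QP.≤-trans 0≤1

*-nonNeg : ∀ {p q} → 0ℚ Q.≤ p → 0ℚ Q.≤ q → 0ℚ Q.≤ p Q.* q
*-nonNeg {p} {q} 0≤p 0≤q =
  QP.nonNegative⁻¹ _ {{QP.nonNeg*nonNeg⇒nonNeg p {{Q.nonNegative 0≤p}} q {{Q.nonNegative 0≤q}}}}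

*-mono-≤ : ∀ {p p′ q q′} → 0ℚ Q.≤ p → 0ℚ Q.≤ q → p Q.≤ p′ → q Q.≤ q′ → p Q.* q Q.≤ p′ Q.* q′
*-mono-≤ {p} {p′} {q} {q′} 0≤p 0≤q p≤p′ q≤q′ =
  QP.≤-trans (QP.*-monoʳ-≤-nonNeg q {{Q.nonNegative 0≤q}} p≤p′)
             (QP.*-monoˡ-≤-nonNeg p′ {{Q.nonNegative (QP.≤-trans 0≤p p≤p′)}} q≤q′)

p≤q*p : ∀ {p q} → 0ℚ Q.≤ p → 1ℚ Q.≤ q → p Q.≤ q Q.* p
p≤q*p {p} {q} 0≤p 1≤q =
  subst (Q._≤ q Q.* p) (QP.*-identityˡ p) (QP.*-monoʳ-≤-nonNeg p {{Q.nonNegative 0≤p}} {1ℚ} {q} 1≤q)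

p≤p+q : ∀ p {q} → 0ℚ Q.≤ q → p Q.≤ p Q.+ q
p≤p+q p 0≤q = subst (Q._≤ p Q.+ _) (QP.+-identityʳ p) (QP.+-monoʳ-≤ p 0≤q)

1≤* : ∀ {p q} → 1ℚ Q.≤ p → 1ℚ Q.≤ q → 1ℚ Q.≤ p Q.* q
1≤* {p} {q} 1≤p 1≤q = QP.≤-trans 1≤p (subst (p Q.≤_) (QP.*-comm q p) (p≤q*p (1≤⇒0≤ 1≤p) 1≤q))

^ℚ-nonNeg : ∀ {q} m → 0ℚ Q.≤ q → 0ℚ Q.≤ q ^ℚ m
^ℚ-nonNeg zero    0≤q = 0≤1
^ℚ-nonNeg (suc m) 0≤q = *-nonNeg 0≤q (^ℚ-nonNeg m 0≤q)

1≤^ℚ : ∀ {q} m → 1ℚ Q.≤ q → 1ℚ Q.≤ q ^ℚ m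
1≤^ℚ zero    1≤q = QP.≤-refl
1≤^ℚ (suc m) 1≤q = 1≤* 1≤q (1≤^ℚ m 1≤q)

^ℚ-monoˡ-≤ : ∀ {p q} m → 0ℚ Q.≤ p → p Q.≤ q → p ^ℚ m Q.≤ q ^ℚ m
^ℚ-monoˡ-≤ zero    0≤p p≤q = QP.≤-refl
^ℚ-monoˡ-≤ (suc m) 0≤p p≤q = *-mono-≤ 0≤p (^ℚ-nonNeg m 0≤p) p≤q (^ℚ-monoˡ-≤ m 0≤p p≤q)

^ℚ-distribˡ-+-* : ∀ q m n → q ^ℚ (m ℕ.+ n) ≡ q ^ℚ m Q.* q ^ℚ n
^ℚ-distribˡ-+-* q zero    n = sym (QP.*-identityˡ _)
^ℚ-distribˡ-+-* q (suc m) n = trans (cong (q Q.*_) (^ℚ-distribˡ-+-* q m n)) (sym (QP.*-assoc q _ _))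

^ℚ-distribʳ-* : ∀ p q m → (p Q.* q) ^ℚ m ≡ p ^ℚ m Q.* q ^ℚ m
^ℚ-distribʳ-* p q zero    = refl
^ℚ-distribʳ-* p q (suc m) rewrite ^ℚ-distribʳ-* p q m =
  solve 4 (λ p q x y → (p :* q) :* (x :* y) := (p :* x) :* (q :* y)) refl p q (p ^ℚ m) (q ^ℚ m)
  where open +-*-Solver

⟦⟧-^ : ∀ p i → ⟦ p ⟧ ^ℚ i ≡ ⟦ p ℕ.^ i ⟧
⟦⟧-^ p zero    = refl
⟦⟧-^ p (suc i) = trans (cong (⟦ p ⟧ Q.*_) (⟦⟧-^ p i)) (⟦⟧-* p (p ℕ.^ i))

Σℚ-nonNeg : ∀ (h : ℕ → ℚ) m → (∀ i → 0ℚ Q.≤ h i) → 0ℚ Q.≤ Σℚ (applyUpTo h m)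
Σℚ-nonNeg h zero    0≤h = QP.≤-refl
Σℚ-nonNeg h (suc m) 0≤h = QP.+-mono-≤ (0≤h 0) (Σℚ-nonNeg (λ i → h (suc i)) m (λ i → 0≤h (suc i)))

Σℚ-mono-≤ : ∀ (f g : ℕ → ℚ) m → (∀ i → f i Q.≤ g i) → Σℚ (applyUpTo f m) Q.≤ Σℚ (applyUpTo g m)
Σℚ-mono-≤ f g zero    f≤g = QP.≤-refl
Σℚ-mono-≤ f g (suc m) f≤g =
  QP.+-mono-≤ (f≤g 0) (Σℚ-mono-≤ (λ i → f (suc i)) (λ i → g (suc i)) m (λ i → f≤g (suc i)))

Σℚ-monoˡ-length : ∀ (h : ℕ → ℚ) {m N} → (∀ i → 0ℚ Q.≤ h i) → m ≤ N →
  Σℚ (applyUpTo h m) Q.≤ Σℚ (applyUpTo h N)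
Σℚ-monoˡ-length h {N = N} 0≤h z≤n = Σℚ-nonNeg h N 0≤h
Σℚ-monoˡ-length h 0≤h (s≤s m≤N) =
  QP.+-mono-≤ (QP.≤-refl {h 0}) (Σℚ-monoˡ-length (λ i → h (suc i)) (λ i → 0≤h (suc i)) m≤N)

head≤Σℚ : ∀ (h : ℕ → ℚ) m → (∀ i → 0ℚ Q.≤ h i) → h 0 Q.≤ Σℚ (applyUpTo h (suc m))
head≤Σℚ h m 0≤h =
  subst (Q._≤ Σℚ (applyUpTo h (suc m))) (QP.+-identityʳ (h 0))
        (QP.+-mono-≤ (QP.≤-refl {h 0}) (Σℚ-nonNeg (λ i → h (suc i)) m (λ i → 0≤h (suc i))))

module _ {A : Set} where

  Πℚ-nonNeg : ∀ (F : A → ℚ) L → (∀ i → 0ℚ Q.≤ F i) → 0ℚ Q.≤ Πℚ (map F L)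
  Πℚ-nonNeg F []      0≤F = 0≤1
  Πℚ-nonNeg F (x ∷ L) 0≤F = *-nonNeg (0≤F x) (Πℚ-nonNeg F L 0≤F)

  Πℚ-mono-≤ : ∀ (F G : A → ℚ) L → (∀ i → 0ℚ Q.≤ F i) → (∀ i → F i Q.≤ G i) →
    Πℚ (map F L) Q.≤ Πℚ (map G L)
  Πℚ-mono-≤ F G []      0≤F F≤G = QP.≤-refl
  Πℚ-mono-≤ F G (x ∷ L) 0≤F F≤G = *-mono-≤ (0≤F x) (Πℚ-nonNeg F L 0≤F) (F≤G x) (Πℚ-mono-≤ F G L 0≤F F≤G)

  Πℚ-map-* : ∀ (F G : A → ℚ) L → Πℚ (map (λ i → F i Q.* G i) L) ≡ Πℚ (map F L) Q.* Πℚ (map G L)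
  Πℚ-map-* F G []      = refl
  Πℚ-map-* F G (x ∷ L) rewrite Πℚ-map-* F G L =
    solve 4 (λ a b c d → (a :* b) :* (c :* d) := (a :* c) :* (b :* d)) refl
            (F x) (G x) (Πℚ (map F L)) (Πℚ (map G L))
    where open +-*-Solver

  Πℚ-map-^ℚ : ∀ q (D : A → ℕ) L → Πℚ (map (λ i → q ^ℚ D i) L) ≡ q ^ℚ foldr ℕ._+_ 0 (map D L)
  Πℚ-map-^ℚ q D []      = refl
  Πℚ-map-^ℚ q D (x ∷ L) =
    trans (cong (q ^ℚ D x Q.*_) (Πℚ-map-^ℚ q D L)) (sym (^ℚ-distribˡ-+-* q (D x) _))

  Πℚ-filter-≤ : ∀ {p} {P : Pred A p} (P? : Decidable P) (F : A → ℚ) L → (∀ i → 1ℚ Q.≤ F i) →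
    Πℚ (map F (filter P? L)) Q.≤ Πℚ (map F L)
  Πℚ-filter-≤ P? F []      1≤F = QP.≤-refl
  Πℚ-filter-≤ P? F (x ∷ L) 1≤F with does (P? x)
  ... | true  = QP.*-monoˡ-≤-nonNeg (F x) {{Q.nonNegative (1≤⇒0≤ (1≤F x))}} (Πℚ-filter-≤ P? F L 1≤F)
  ... | false = QP.≤-trans (Πℚ-filter-≤ P? F L 1≤F)
                           (p≤q*p (Πℚ-nonNeg F L (λ i → 1≤⇒0≤ (1≤F i))) (1≤F x))

falling-≤-^ : ∀ x r → falling x r ≤ x ℕ.^ r
falling-≤-^ x zero    = s≤s z≤n
falling-≤-^ x (suc r) = ℕP.*-mono-≤ (ℕP.m∸n≤m x r) (falling-≤-^ x r)

falling-even-≤ : ∀ x j → falling x (2 ℕ.* j) ≤ (x ℕ.* x) ℕ.^ j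
falling-even-≤ x j = subst (falling x (2 ℕ.* j) ≤_) x^2j≡[x*x]^j (falling-≤-^ x (2 ℕ.* j))
  where
  x^2j≡[x*x]^j : x ℕ.^ (2 ℕ.* j) ≡ (x ℕ.* x) ℕ.^ j
  x^2j≡[x*x]^j = trans (sym (ℕP.^-*-assoc x 2 j)) (cong (λ y → (x ℕ.* y) ℕ.^ j) (ℕP.*-identityʳ x))

inv2k : ℕ → ℚ
inv2k k' = + 1 Q./ (2 ℕ.* suc k')

involTerm : ℕ → ℕ → ℕ → ℚ
involTerm k' x j = ⟦ falling x (2 ℕ.* j) ⟧ Q.* (inv2k k' ^ℚ j) Q.* inv! j

expTerm : ℚ → ℕ → ℚ
expTerm c i = (c ^ℚ i) Q.* inv! i

involFactor≡Σ : ∀ k' x → involFactor k' x ≡ ⟦ suc k' ⟧ ^ℚ x Q.* Σℚ (applyUpTo (involTerm k' x) (suc (x ℕ./ 2)))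
involFactor≡Σ k' x = cong (λ L → ⟦ suc k' ⟧ ^ℚ x Q.* Σℚ L) (map-upTo (involTerm k' x) (suc (x ℕ./ 2)))

expPartial≡Σ : ∀ N c → expPartial N c ≡ Σℚ (applyUpTo (expTerm c) N)
expPartial≡Σ N c = cong Σℚ (map-upTo (expTerm c) N)

0≤inv! : ∀ j → 0ℚ Q.≤ inv! j
0≤inv! j = QP.nonNegative⁻¹ _ {{QP.normalize-nonNeg 1 (j ℕ.!) {{j ℕP.!≢0}}}}

0≤inv2k : ∀ k' → 0ℚ Q.≤ inv2k k'
0≤inv2k k' = QP.nonNegative⁻¹ _ {{QP.normalize-nonNeg 1 (2 ℕ.* suc k')}}

0≤involTerm : ∀ k' x j → 0ℚ Q.≤ involTerm k' x j
0≤involTerm k' x j = *-nonNeg (*-nonNeg (0≤⟦⟧ (falling x (2 ℕ.* j))) (^ℚ-nonNeg j (0≤inv2k k'))) (0≤inv! j)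

0≤expTerm : ∀ {c} → 0ℚ Q.≤ c → ∀ i → 0ℚ Q.≤ expTerm c i
0≤expTerm 0≤c i = *-nonNeg (^ℚ-nonNeg i 0≤c) (0≤inv! i)

0≤expPartial : ∀ N {c} → 0ℚ Q.≤ c → 0ℚ Q.≤ expPartial N c
0≤expPartial N {c} 0≤c = subst (0ℚ Q.≤_) (sym (expPartial≡Σ N c)) (Σℚ-nonNeg (expTerm c) N (0≤expTerm 0≤c))

1≤expPartial : ∀ N {c} → 0ℚ Q.≤ c → 1ℚ Q.≤ expPartial (suc N) c
1≤expPartial N {c} 0≤c =
  subst (1ℚ Q.≤_) (sym (expPartial≡Σ (suc N) c)) (head≤Σℚ (expTerm c) N (0≤expTerm 0≤c))

involTerm-≤-expTerm : ∀ k' x j → involTerm k' x j Q.≤ expTerm (⟦ x ℕ.* x ⟧ Q.* inv2k k') j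
involTerm-≤-expTerm k' x j = QP.*-monoʳ-≤-nonNeg (inv! j) {{Q.nonNegative (0≤inv! j)}} (begin
  ⟦ falling x (2 ℕ.* j) ⟧ Q.* inv2k k' ^ℚ j   ≤⟨ QP.*-monoʳ-≤-nonNeg (inv2k k' ^ℚ j)
                                                     {{Q.nonNegative (^ℚ-nonNeg j (0≤inv2k k'))}}
                                                     (⟦⟧-mono-≤ (falling-even-≤ x j)) ⟩
  ⟦ (x ℕ.* x) ℕ.^ j ⟧ Q.* inv2k k' ^ℚ j      ≡⟨ cong (Q._* inv2k k' ^ℚ j) (⟦⟧-^ (x ℕ.* x) j) ⟨
  ⟦ x ℕ.* x ⟧ ^ℚ j Q.* inv2k k' ^ℚ j         ≡⟨ ^ℚ-distribʳ-* ⟦ x ℕ.* x ⟧ (inv2k k') j ⟨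
  (⟦ x ℕ.* x ⟧ Q.* inv2k k') ^ℚ j            ∎)
  where open QP.≤-Reasoning

involFactor-≤-expPartial : ∀ k' x N → suc (x ℕ./ 2) ≤ N →
  involFactor k' x Q.≤ ⟦ suc k' ⟧ ^ℚ x Q.* expPartial N (⟦ x ℕ.* x ⟧ Q.* inv2k k')
involFactor-≤-expPartial k' x N x/2<N = begin
  involFactor k' x                                           ≡⟨ involFactor≡Σ k' x ⟩
  K^x Q.* Σℚ (applyUpTo (involTerm k' x) (suc (x ℕ./ 2)))   ≤⟨ QP.*-monoˡ-≤-nonNeg K^x {{Q.nonNegative 0≤K^x}} Σ≤ ⟩
  K^x Q.* Σℚ (applyUpTo (expTerm c) N)                       ≡⟨ cong (K^x Q.*_) (expPartial≡Σ N c) ⟨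
  K^x Q.* expPartial N c                                     ∎
  where
  open QP.≤-Reasoning
  K^x = ⟦ suc k' ⟧ ^ℚ x
  c = ⟦ x ℕ.* x ⟧ Q.* inv2k k'
  0≤K^x = ^ℚ-nonNeg x (0≤⟦⟧ (suc k'))
  Σ≤ = QP.≤-trans (Σℚ-mono-≤ (involTerm k' x) (expTerm c) (suc (x ℕ./ 2)) (involTerm-≤-expTerm k' x))
                  (Σℚ-monoˡ-length (expTerm c) (0≤expTerm (*-nonNeg (0≤⟦⟧ (x ℕ.* x)) (0≤inv2k k'))) x/2<N)

^≤involFactor : ∀ k' x → ⟦ suc k' ⟧ ^ℚ x Q.≤ involFactor k' x
^≤involFactor k' x = begin
  K^x                                                        ≡⟨ QP.*-identityʳ K^x ⟨
  K^x Q.* involTerm k' x 0                                   ≤⟨ QP.*-monoˡ-≤-nonNeg K^x {{Q.nonNegative 0≤K^x}}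
                                                                  (head≤Σℚ (involTerm k' x) (x ℕ./ 2) (0≤involTerm k' x)) ⟩
  K^x Q.* Σℚ (applyUpTo (involTerm k' x) (suc (x ℕ./ 2)))   ≡⟨ involFactor≡Σ k' x ⟨
  involFactor k' x                                           ∎
  where
  open QP.≤-Reasoning
  K^x = ⟦ suc k' ⟧ ^ℚ x
  0≤K^x = ^ℚ-nonNeg x (0≤⟦⟧ (suc k'))

0≤involFactor : ∀ k' x → 0ℚ Q.≤ involFactor k' x
0≤involFactor k' x = QP.≤-trans (^ℚ-nonNeg x (0≤⟦⟧ (suc k'))) (^≤involFactor k' x)

involFactor-≤ : ∀ {n k' a b} N → suc k' ≤ n → a ≤ b → suc (b ℕ./ 2) ≤ N →
  involFactor k' b Q.≤ involFactor k' a Q.* (⟦ n ⟧ ^ℚ (b ∸ a) Q.* expPartial N (⟦ b ℕ.* b ⟧ Q.* inv2k k'))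
involFactor-≤ {n} {k'} {a} {b} N k≤n a≤b b/2<N = begin
  involFactor k' b                        ≤⟨ involFactor-≤-expPartial k' b N b/2<N ⟩
  K ^ℚ b Q.* E                            ≡⟨ cong (λ e → K ^ℚ e Q.* E) (ℕP.m+[n∸m]≡n a≤b) ⟨
  K ^ℚ (a ℕ.+ (b ∸ a)) Q.* E              ≡⟨ cong (Q._* E) (^ℚ-distribˡ-+-* K a (b ∸ a)) ⟩
  K ^ℚ a Q.* K ^ℚ (b ∸ a) Q.* E           ≡⟨ QP.*-assoc (K ^ℚ a) _ E ⟩
  K ^ℚ a Q.* (K ^ℚ (b ∸ a) Q.* E)         ≤⟨ *-mono-≤ (^ℚ-nonNeg a 0≤K) (*-nonNeg (^ℚ-nonNeg (b ∸ a) 0≤K) 0≤E)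
                                               (^≤involFactor k' a)
                                               (QP.*-monoʳ-≤-nonNeg E {{Q.nonNegative 0≤E}}
                                                  (^ℚ-monoˡ-≤ (b ∸ a) 0≤K (⟦⟧-mono-≤ k≤n))) ⟩
  involFactor k' a Q.* (⟦ n ⟧ ^ℚ (b ∸ a) Q.* E) ∎
  where
  open QP.≤-Reasoning
  K = ⟦ suc k' ⟧
  E = expPartial N (⟦ b ℕ.* b ⟧ Q.* inv2k k')
  0≤K = 0≤⟦⟧ (suc k')
  0≤E = 0≤expPartial N (*-nonNeg (0≤⟦⟧ (b ℕ.* b)) (0≤inv2k k'))

invol-≤ : ∀ {n} m (a b : Fin n → ℕ) M → n > 0 → (∀ i → a i ≤ b i) → (∀ i → b i ≤ M) →
  invol m b Q.≤ invol m a Q.* ⟦ n ⟧ ^ℚ dist₁ b a Q.* Πℚ (map (λ i → expPartial (suc M) (expArg b i)) (allFin n))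
invol-≤ {n} m a b M n>0 a≤b b≤M = begin
  Πℚ (map Fb (filter P? L))                     ≤⟨ Πℚ-mono-≤ Fb (λ i → Fa i Q.* T i) (filter P? L) 0≤Fb Fb≤Fa*T ⟩
  Πℚ (map (λ i → Fa i Q.* T i) (filter P? L))   ≡⟨ Πℚ-map-* Fa T (filter P? L) ⟩
  ΠFa Q.* Πℚ (map T (filter P? L))              ≤⟨ QP.*-monoˡ-≤-nonNeg ΠFa {{Q.nonNegative 0≤ΠFa}}
                                                      (Πℚ-filter-≤ P? T L 1≤T) ⟩
  ΠFa Q.* Πℚ (map T L)                          ≡⟨ cong (ΠFa Q.*_) ΠT ⟩
  ΠFa Q.* (⟦ n ⟧ ^ℚ dist₁ b a Q.* Πℚ (map E L)) ≡⟨ QP.*-assoc ΠFa (⟦ n ⟧ ^ℚ dist₁ b a) (Πℚ (map E L)) ⟨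
  ΠFa Q.* ⟦ n ⟧ ^ℚ dist₁ b a Q.* Πℚ (map E L)   ∎
  where
  open QP.≤-Reasoning
  L = allFin n
  P? = λ (i : Fin n) → toℕ i ℕ.<? m
  Fa Fb E T : Fin n → ℚ
  Fa i = involFactor (toℕ i) (a i)
  Fb i = involFactor (toℕ i) (b i)
  E i = expPartial (suc M) (expArg b i)
  T i = ⟦ n ⟧ ^ℚ (b i ∸ a i) Q.* E i
  ΠFa = Πℚ (map Fa (filter P? L))
  0≤Fa : ∀ i → 0ℚ Q.≤ Fa i
  0≤Fa i = 0≤involFactor (toℕ i) (a i)
  0≤ΠFa : 0ℚ Q.≤ ΠFa
  0≤ΠFa = Πℚ-nonNeg Fa (filter P? L) 0≤Fa
  0≤Fb : ∀ i → 0ℚ Q.≤ Fb i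
  0≤Fb i = 0≤involFactor (toℕ i) (b i)
  Fb≤Fa*T : ∀ i → Fb i Q.≤ Fa i Q.* T i
  Fb≤Fa*T i = involFactor-≤ (suc M) (toℕ<n i) (a≤b i) (s≤s (ℕP.≤-trans (m/n≤m (b i) 2) (b≤M i)))
  1≤T : ∀ i → 1ℚ Q.≤ T i
  1≤T i = 1≤* (1≤^ℚ (b i ∸ a i) (⟦⟧-mono-≤ n>0))
              (1≤expPartial M (*-nonNeg (0≤⟦⟧ (b i ℕ.* b i)) (0≤inv2k (toℕ i))))
  ΠT : Πℚ (map T L) ≡ ⟦ n ⟧ ^ℚ dist₁ b a Q.* Πℚ (map E L)
  ΠT = trans (Πℚ-map-* (λ i → ⟦ n ⟧ ^ℚ (b i ∸ a i)) E L)
             (cong (Q._* Πℚ (map E L)) (Πℚ-map-^ℚ ⟦ n ⟧ (λ i → b i ∸ a i) L))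

maximum : ∀ {n} → (Fin n → ℕ) → ℕ
maximum {zero}  b = 0
maximum {suc n} b = b Data.Fin.zero ⊔ maximum (λ i → b (Data.Fin.suc i))

≤-maximum : ∀ {n} (b : Fin n → ℕ) i → b i ≤ maximum b
≤-maximum {suc n} b Data.Fin.zero    = ℕP.m≤m⊔n _ _
≤-maximum {suc n} b (Data.Fin.suc i) = ℕP.≤-trans (≤-maximum (λ i → b (Data.Fin.suc i)) i) (ℕP.m≤n⊔m _ _)

lemma5p3 : (n : ℕ) → n > 0 → (a b : Fin n → ℕ) → (∀ k → a k ≤ b k) → (j : Fin n) →
    invol (suc (toℕ j)) b ≤ (invol (suc (toℕ j)) a Data.Rational.* (⟦ n ⟧ ^ℚ dist₁ b a)) ·Πexp (expArg b)
lemma5p3 n n>0 a b a≤b j ε 0<ε =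
  suc (maximum b) ,
  QP.≤-trans (invol-≤ (suc (toℕ j)) a b (maximum b) n>0 a≤b (≤-maximum b))
             (p≤p+q _ (QP.<⇒≤ 0<ε))
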